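{- Let $q$ be a prime power, let $F$ be a field containing $\mathbb{F}_q$, let $d\ge 0$, and let $f(z)=\sum_{i=0}^{d} f_i z^{q^i}\in F[z]$ with $f_d\neq 0$. Put $u=1/z$ and expand $-zf'(z)/(1-f(z))=\sum_{i\ge 0}\mathcal{A}_i u^i$ as a power series in $u$. Then for every integer $s$ with $1\le s<q$ and all integers $k_1,\dots,k_s\ge 0$, $$\prod_{j=1}^s \mathcal{A}_{q^{k_j}-1} = f_0^{s-1}\, \mathcal{A}_{q^{k_1}+\dots+q^{k_s}-1}.$$
   Context: Here $f'(z)=f_0$, and $zf'(z)/(1-f(z))=f_0z/(1-f(z))$ is a power series in $u=1/z$ since $f$ is a polynomial of degree $q^d$. -}

module Defs where

open import Level using (Level; _⊔_)
open import Algebra.Bundles using (CommutativeRing; Semiring; RawSemiring)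
import Algebra.Definitions.RawSemiring as RS
open import Data.Nat as ℕ using (ℕ; zero; suc)
open import Data.Nat.Primality using (Prime)
open import Data.Integer as ℤ using (ℤ; +_; -[1+_])
open import Data.Fin using (Fin)
open import Data.Product using (Σ; ∃; _×_)
open import Data.Bool using (if_then_else_)
open import Relation.Nullary using (¬_; does)
open import Relation.Binary.PropositionalEquality using (_≡_)

IsPrimePower : ℕ → Set
IsPrimePower q = Σ ℕ λ p → Σ ℕ λ m → Prime p × (1 ℕ.≤ m) × (q ≡ p ℕ.^ m)

module _ {c ℓ : Level} (R : CommutativeRing c ℓ) where
  open CommutativeRing R hiding (zero)
  rawSR : RawSemiring c ℓ
  rawSR = Semiring.rawSemiring semiring

  open RS rawSR using (_^_; sum; product) renaming (_×_ to _·_)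

  record IsField : Set (c ⊔ ℓ) where
    field
      1≉0     : ¬ (1# ≈ 0#)
      inverse : ∀ x → ¬ (x ≈ 0#) → ∃ λ y → (x * y) ≈ 1#

  -- F contains (a copy of) the finite field 𝔽_q: there is a subfield of F with
  -- exactly q elements, given as an injective enumeration ι : Fin q → F whose
  -- image contains 0 and 1 and is closed under +, -, * and inverses of nonzero elements.
  record ContainsFq (q : ℕ) : Set (c ⊔ ℓ) where
    field
      ι       : Fin q → Carrier
      ι-inj   : ∀ a b → ι a ≈ ι b → a ≡ b
      has-0   : ∃ λ a → ι a ≈ 0#
      has-1   : ∃ λ a → ι a ≈ 1#
      cl-+    : ∀ a b → ∃ λ e → ι e ≈ (ι a + ι b)
      cl-neg  : ∀ a → ∃ λ e → ι e ≈ (- ι a)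
      cl-*    : ∀ a b → ∃ λ e → ι e ≈ (ι a * ι b)
      cl-inv  : ∀ a → ¬ (ι a ≈ 0#) → ∃ λ e → (ι a * ι e) ≈ 1#

  sumTo : ℕ → (ℕ → Carrier) → Carrier
  sumTo zero    g = g zero
  sumTo (suc d) g = sumTo d g + g (suc d)

  ext : (ℕ → Carrier) → ℤ → Carrier
  ext A (+ n)    = A n
  ext A -[1+ n ] = 0#

  -- f(z) = Σ_{i=0}^{d} f_i z^(q^i) has formal derivative f'(z) = Σ_{i=0}^{d} (q^i · f_i) z^(q^i - 1),
  -- so -z f'(z) = Σ_i -(q^i · f_i) z^(q^i) = Σ_i -(q^i · f_i) u^(-q^i), with u = 1/z.
  -- Likewise 1 - f(z) = 1 - Σ_i f_i u^(-q^i).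
  -- (A_i) is the power-series expansion of -z f'(z)/(1 - f(z)) in u iff
  --   (1 - f(z)) · Σ_{i≥0} A_i u^i = -z f'(z)
  -- as Laurent series in u, i.e. iff for every integer n the coefficients of u^n agree:
  --   A_n - Σ_i f_i A_{n + q^i} = Σ_i [n = -q^i] · (-(q^i · f_i))      (A_m := 0 for m < 0).
  IsExpansion : (q d : ℕ) (f : ℕ → Carrier) (A : ℕ → Carrier) → Set ℓ
  IsExpansion q d f A =
    ∀ (n : ℤ) →
      (ext A n - sumTo d (λ i → f i * ext A (n ℤ.+ + (q ℕ.^ i))))
      ≈ sumTo d (λ i → if does (n ℤ.≟ ℤ.- (+ (q ℕ.^ i)))
                         then - ((q ℕ.^ i) · f i)
                         else 0#)

module Submission where

open import Defs
open import Level using (Level; _⊔_)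
open import Algebra.Bundles using (Semiring; CommutativeSemiring; CommutativeRing)
open import Algebra.Structures using (IsCommutativeSemiring)
open import Algebra.Structures.Biased using (isCommutativeSemiringˡ; isCommutativeMonoidˡ)
import Algebra.Definitions.RawSemiring as RS
open import Data.Bool using (Bool; true; false; if_then_else_)
open import Data.Empty using (⊥-elim)
open import Data.Fin as Fin using (Fin; toℕ; inject₁; fromℕ)
open import Data.Fin.Properties using (toℕ<n; toℕ-inject₁; toℕ-fromℕ)
open import Data.Integer as ℤ using (-[1+_])
import Data.Integer.Properties as ℤ
open import Data.List as List using (List; []; _∷_)
open import Data.Nat as ℕ using (ℕ; zero; suc; _≤_; _<_; _∸_; _!; s≤s; z≤n)
import Data.Nat.Properties as ℕ
open import Data.Nat.Combinatorics using (_C_; nCn≡1; nCk≡n!/k![n-k]!; k![n∸k]!∣n!)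
open import Data.Nat.Divisibility using (_∣_; _∤_; divides; ∣⇒≤; m∣m*n)
open import Data.Nat.DivMod using (m/n*n≡m)
open import Data.Nat.Induction using (<-rec)
open import Data.Nat.Primality using (Prime; euclidsLemma; prime⇒nonZero; prime⇒nonTrivial)
open import Data.Product using (∃; _,_; proj₁; proj₂)
open import Data.Sum using (inj₁; inj₂)
open import Function using (_∘_)
open import Function.Bundles using (mk↔ₛ′)
open import Relation.Binary.PropositionalEquality as ≡ using (_≡_)
open import Relation.Binary.Structures using (IsEquivalence)
open import Relation.Nullary using (¬_; yes; no; does)

-- Put b 0 = f 0 and b (n + 1) = A n.  Since F contains 𝔽_q it has characteristic p, so only f₀ survives
-- in f′, and comparing coefficients in (1 − f(z)) Σ Aᵢ uⁱ = −z f′(z) gives the recurrence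
-- b n = Σᵢ fᵢ b (n + qⁱ) for all n ≥ 0, while the equations at u^(−k), k ≥ 2, make b vanish on [1, q^d).
-- Let T be the shift on sequences.  The recurrence writes T^(q^d) b in terms of b and the T^(qⁱ) b, i < d,
-- and since raising to the q-th power is additive on the commutative ring F[T] of characteristic p,
-- induction on m writes every T^(q^m) b as κₘ b + Σ_{i<d} λ_{m,i} T^(qⁱ) b.  Applying these relations to
-- the summands of q^k₁ + ⋯ + q^kₛ one at a time, every term except κ b X lands on an index in [1, q^d)
-- as long as fewer than q powers have been added, so b (q^k₁ + ⋯ + q^kₛ) = κ_k₁ ⋯ κ_kₛ f₀ for s < q;
-- the case s = 1 reads A (q^k − 1) = κ_k f₀.

n∣n! : ∀ n → .{{ℕ.NonZero n}} → n ∣ n !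
n∣n! (suc n) = m∣m*n (n !)

nCk*[k!*[n∸k]!]≡n! : ∀ {n k} → k ≤ n → (n C k) ℕ.* (k ! ℕ.* (n ∸ k) !) ≡ n !
nCk*[k!*[n∸k]!]≡n! {n} {k} k≤n =
  ≡.trans (≡.cong (ℕ._* (k ! ℕ.* (n ∸ k) !)) (nCk≡n!/k![n-k]! k≤n)) (m/n*n≡m {{_}} (k![n∸k]!∣n! k≤n))

module _ {p : ℕ} (p-prime : Prime p) where

  prime≥2 : 2 ≤ p
  prime≥2 = ℕ.nonTrivial⇒n>1 p {{prime⇒nonTrivial p-prime}}

  prime∤! : ∀ m → m < p → p ∤ m !
  prime∤! zero    _   p∣1 = ℕ.<⇒≱ prime≥2 (∣⇒≤ p∣1)
  prime∤! (suc m) m<p p∣m! with euclidsLemma (suc m) (m !) p-prime p∣m!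
  ... | inj₁ p∣1+m = ℕ.<⇒≱ m<p (∣⇒≤ p∣1+m)
  ... | inj₂ p∣m!  = prime∤! m (ℕ.<-trans (ℕ.n<1+n m) m<p) p∣m!

  prime∣pCk : ∀ {k} → 0 < k → k < p → p ∣ p C k
  prime∣pCk {k} 0<k k<p
    with euclidsLemma (p C k) (k ! ℕ.* (p ∸ k) !) p-prime
           (≡.subst (p ∣_) (≡.sym (nCk*[k!*[n∸k]!]≡n! (ℕ.<⇒≤ k<p))) (n∣n! p {{prime⇒nonZero p-prime}}))
  ... | inj₁ p∣pCk = p∣pCk
  ... | inj₂ p∣k!*[p∸k]! with euclidsLemma (k !) ((p ∸ k) !) p-prime p∣k!*[p∸k]!
  ...   | inj₁ p∣k!     = ⊥-elim (prime∤! k k<p p∣k!)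
  ...   | inj₂ p∣[p∸k]! = ⊥-elim (prime∤! (p ∸ k) (ℕ.∸-monoʳ-< 0<k (ℕ.<⇒≤ k<p)) p∣[p∸k]!)

module Multiples {a ℓ} (S : Semiring a ℓ) {n : ℕ}
  (n×1≈0 : Semiring._≈_ S (RS._×_ (Semiring.rawSemiring S) n (Semiring.1# S)) (Semiring.0# S)) where

  open Semiring S
  open import Algebra.Properties.Semiring.Mult S using (_×_; ×-assocˡ; ×-assoc-*; ×-congʳ)
  open import Relation.Binary.Reasoning.Setoid setoid

  n×-vanishes : ∀ x → n × x ≈ 0#
  n×-vanishes x = begin
    n × x        ≈⟨ ×-congʳ n (*-identityˡ x) ⟨
    n × (1# * x) ≈⟨ ×-assoc-* n 1# x ⟨
    n × 1# * x   ≈⟨ *-congʳ n×1≈0 ⟩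
    0# * x       ≈⟨ zeroˡ x ⟩
    0#           ∎

  ×-vanishes : ∀ {m} → n ∣ m → ∀ x → m × x ≈ 0#
  ×-vanishes (divides r ≡.refl) x = begin
    (r ℕ.* n) × x ≡⟨ ≡.cong (_× x) (ℕ.*-comm r n) ⟩
    (n ℕ.* r) × x ≈⟨ ×-assocˡ x n r ⟨
    n × (r × x)   ≈⟨ n×-vanishes (r × x) ⟩
    0#            ∎

module Frobenius {a ℓ} (S : CommutativeSemiring a ℓ) {p : ℕ} (p-prime : Prime p)
  (char-p : CommutativeSemiring._≈_ S (RS._×_ (CommutativeSemiring.rawSemiring S) p (CommutativeSemiring.1# S))
                                      (CommutativeSemiring.0# S)) where

  open CommutativeSemiring S
  open import Algebra.Properties.Semiring.Mult semiring using (_×_; ×-cong)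
  open import Algebra.Properties.Semiring.Exp semiring using (_^_; ^-congˡ; ^-congʳ; ^-assocʳ)
  open import Algebra.Properties.Semiring.Sum semiring using (sum; sum-cong-≋; sum-init-last; sum-replicate-zero)
  open import Algebra.Properties.CommutativeSemiring.Binomial S using (binomialTerm) renaming (theorem to binomial-theorem)
  open Multiples semiring {p} char-p using (×-vanishes)
  open import Relation.Binary.Reasoning.Setoid setoid

  freshmans-dream : ∀ m → .{{ℕ.NonZero m}} → (∀ {k} → 0 < k → k < m → p ∣ m C k) →
             ∀ x y → (x + y) ^ m ≈ x ^ m + y ^ m
  freshmans-dream (suc n) p∣mCk x y = begin
    (x + y) ^ m                                          ≈⟨ binomial-theorem m x y ⟩
    term Fin.zero + sum (λ i → term (Fin.suc i))         ≈⟨ +-congˡ (sum-init-last (λ i → term (Fin.suc i))) ⟩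
    term Fin.zero + (sum middle + term (fromℕ m))        ≈⟨ +-congˡ (+-congʳ middle-vanishes) ⟩
    term Fin.zero + (0# + term (fromℕ m))                ≈⟨ +-cong first-term (+-identityˡ _) ⟩
    y ^ m + term (fromℕ m)                               ≈⟨ +-congˡ last-term ⟩
    y ^ m + x ^ m                                        ≈⟨ +-comm _ _ ⟩
    x ^ m + y ^ m                                        ∎
    where
    m = suc n
    term = binomialTerm x y m
    middle : Fin n → Carrier
    middle i = term (Fin.suc (inject₁ i))
    middle-vanishes : sum middle ≈ 0#
    middle-vanishes = trans (sum-cong-≋ (λ i → ×-vanishes (p∣mCk (s≤s z≤n) (index<m i)) _))
                            (sum-replicate-zero n)
      where
      index<m : ∀ i → suc (toℕ (inject₁ i)) < m
      index<m i = s≤s (≡.subst (_< n) (≡.sym (toℕ-inject₁ i)) (toℕ<n i))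
    first-term : term Fin.zero ≈ y ^ m
    first-term = trans (+-identityʳ _) (*-identityˡ _)
    last-term : term (fromℕ m) ≈ x ^ m
    last-term = begin
      (m C toℕ (fromℕ m)) × (x ^ toℕ (fromℕ m) * y ^ (m ∸ toℕ (fromℕ m)))
        ≈⟨ ×-cong (≡.trans (≡.cong (m C_) (toℕ-fromℕ m)) (nCn≡1 m))
                  (*-cong (^-congʳ x (toℕ-fromℕ m))
                          (^-congʳ y (≡.trans (≡.cong (m ∸_) (toℕ-fromℕ m)) (ℕ.n∸n≡0 m)))) ⟩
      1 × (x ^ m * 1#) ≈⟨ trans (+-identityʳ _) (*-identityʳ _) ⟩
      x ^ m ∎

  frobenius : ∀ x y → (x + y) ^ p ≈ x ^ p + y ^ p
  frobenius = freshmans-dream p {{prime⇒nonZero p-prime}} (prime∣pCk p-prime)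

  frobenius-^ : ∀ e x y → (x + y) ^ (p ℕ.^ e) ≈ x ^ (p ℕ.^ e) + y ^ (p ℕ.^ e)
  frobenius-^ zero x y = trans (*-identityʳ _) (+-cong (sym (*-identityʳ x)) (sym (*-identityʳ y)))
  frobenius-^ (suc e) x y = begin
    (x + y) ^ (p ℕ.* q)          ≈⟨ ^-assocʳ (x + y) p q ⟨
    ((x + y) ^ p) ^ q            ≈⟨ ^-congˡ q (frobenius x y) ⟩
    (x ^ p + y ^ p) ^ q          ≈⟨ frobenius-^ e (x ^ p) (y ^ p) ⟩
    (x ^ p) ^ q + (y ^ p) ^ q    ≈⟨ +-cong (^-assocʳ x p q) (^-assocʳ y p q) ⟩
    x ^ (p ℕ.* q) + y ^ (p ℕ.* q) ∎
    where q = p ℕ.^ e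

  frobenius-sum : ∀ e {n} (xs : Fin n → Carrier) → sum xs ^ (p ℕ.^ e) ≈ sum (λ i → xs i ^ (p ℕ.^ e))
  frobenius-sum e {zero} xs = 0#^-vanishes (p ℕ.^ e) {{ℕ.m^n≢0 p e {{prime⇒nonZero p-prime}}}}
    where
    0#^-vanishes : ∀ m → .{{ℕ.NonZero m}} → 0# ^ m ≈ 0#
    0#^-vanishes (suc m) = zeroˡ _
  frobenius-sum e {suc n} xs =
    trans (frobenius-^ e (xs Fin.zero) _) (+-congˡ (frobenius-sum e (λ i → xs (Fin.suc i))))

module FieldProperties {c ℓ} (F : CommutativeRing c ℓ) (F-field : IsField F) where

  open CommutativeRing F
  open IsField F-field
  open import Algebra.Properties.Semiring.Exp semiring using (_^_)
  open import Relation.Binary.Reasoning.Setoid setoid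

  *-cancelˡ-≈0 : ∀ {x y} → ¬ (x ≈ 0#) → x * y ≈ 0# → y ≈ 0#
  *-cancelˡ-≈0 {x} {y} x≉0 xy≈0 = begin
    y             ≈⟨ *-identityˡ y ⟨
    1# * y        ≈⟨ *-congʳ (trans (*-comm _ x) (proj₂ (inverse x x≉0))) ⟨
    (x⁻¹ * x) * y ≈⟨ *-assoc x⁻¹ x y ⟩
    x⁻¹ * (x * y) ≈⟨ *-congˡ xy≈0 ⟩
    x⁻¹ * 0#      ≈⟨ zeroʳ x⁻¹ ⟩
    0#            ∎
    where x⁻¹ = proj₁ (inverse x x≉0)

  ^-≉0 : ∀ {x} → ¬ (x ≈ 0#) → ∀ m → ¬ (x ^ m ≈ 0#)
  ^-≉0 x≉0 zero    = 1≉0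
  ^-≉0 x≉0 (suc m) = ^-≉0 x≉0 m ∘ *-cancelˡ-≈0 x≉0

module Characteristic {c ℓ} (F : CommutativeRing c ℓ) (F-field : IsField F) {q : ℕ} (𝔽q : ContainsFq F q) where

  open CommutativeRing F
  open ContainsFq 𝔽q
  open FieldProperties F F-field using (^-≉0)
  open import Algebra.Properties.Semiring.Mult semiring using (_×_; ×-congʳ; ×1-homo-*)
  open import Algebra.Properties.Semiring.Exp semiring using (_^_)
  open import Algebra.Properties.Semiring.Sum semiring using (sum; sum-cong-≋; ∑-distrib-+; ∑-permute; sum-replicate)
  open import Algebra.Properties.Ring ring using (+-identityʳ-unique)
  open import Relation.Binary.Reasoning.Setoid setoid

  translate : Fin q → Fin q → Fin q
  translate a e = proj₁ (cl-+ e a)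

  translate-inverse : ∀ {a a′} → ι a + ι a′ ≈ 0# → ∀ e → translate a′ (translate a e) ≡ e
  translate-inverse {a} {a′} a+a′≈0 e = ι-inj _ _ (begin
    ι (translate a′ (translate a e)) ≈⟨ proj₂ (cl-+ (translate a e) a′) ⟩
    ι (translate a e) + ι a′         ≈⟨ +-congʳ (proj₂ (cl-+ e a)) ⟩
    (ι e + ι a) + ι a′               ≈⟨ +-assoc _ _ _ ⟩
    ι e + (ι a + ι a′)               ≈⟨ +-congˡ a+a′≈0 ⟩
    ι e + 0#                         ≈⟨ +-identityʳ _ ⟩
    ι e                              ∎)

  q×1≈0 : q × 1# ≈ 0#
  q×1≈0 = +-identityʳ-unique (sum ι) (q × 1#) (sym (begin
    sum ι                            ≈⟨ ∑-permute ι translate-by-one ⟩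
    sum (λ e → ι (translate one e))  ≈⟨ sum-cong-≋ (λ e → proj₂ (cl-+ e one)) ⟩
    sum (λ e → ι e + ι one)          ≈⟨ ∑-distrib-+ {q} ι (λ _ → ι one) ⟩
    sum ι + sum {q} (λ _ → ι one)    ≈⟨ +-congˡ (sum-replicate q) ⟩
    sum ι + q × ι one                ≈⟨ +-congˡ (×-congʳ q (proj₂ has-1)) ⟩
    sum ι + q × 1#                   ∎))
    where
    one = proj₁ has-1
    minus-one = proj₁ (cl-neg one)
    one+minus-one≈0 : ι one + ι minus-one ≈ 0#
    one+minus-one≈0 = trans (+-congˡ (proj₂ (cl-neg one))) (-‿inverseʳ _)
    translate-by-one = mk↔ₛ′ (translate one) (translate minus-one)
      (translate-inverse (trans (+-comm _ _) one+minus-one≈0))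
      (translate-inverse one+minus-one≈0)

  n×1∈𝔽q : ∀ n → ∃ λ e → ι e ≈ n × 1#
  n×1∈𝔽q zero    = has-0
  n×1∈𝔽q (suc n) with n×1∈𝔽q n
  ... | e , ιe≈n×1 = proj₁ (cl-+ (proj₁ has-1) e) ,
                     trans (proj₂ (cl-+ (proj₁ has-1) e)) (+-cong (proj₂ has-1) ιe≈n×1)

  ×1-^ : ∀ n m → (n × 1#) ^ m ≈ (n ℕ.^ m) × 1#
  ×1-^ n zero    = sym (+-identityʳ 1#)
  ×1-^ n (suc m) = trans (*-congˡ (×1-^ n m)) (sym (×1-homo-* n (n ℕ.^ m)))

  -- p · 1 lies in the subfield, where being zero is decidable.
  prime-power⇒char : ∀ {p m} → q ≡ p ℕ.^ m → p × 1# ≈ 0#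
  prime-power⇒char {p} {m} q≡p^m with n×1∈𝔽q p | Fin._≟_ (proj₁ (n×1∈𝔽q p)) (proj₁ has-0)
  ... | e , ιe≈p×1 | yes ≡.refl = trans (sym ιe≈p×1) (proj₂ has-0)
  ... | e , ιe≈p×1 | no  e≢0   = ⊥-elim (^-≉0 p×1≉0 m (begin
    (p × 1#) ^ m     ≈⟨ ×1-^ p m ⟩
    (p ℕ.^ m) × 1#   ≡⟨ ≡.cong (_× 1#) q≡p^m ⟨
    q × 1#           ≈⟨ q×1≈0 ⟩
    0#               ∎))
    where
    p×1≉0 : ¬ (p × 1# ≈ 0#)
    p×1≉0 p×1≈0 = e≢0 (ι-inj _ _ (trans ιe≈p×1 (trans p×1≈0 (sym (proj₂ has-0)))))

module FiniteSums {c ℓ} (F : CommutativeRing c ℓ) where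

  open CommutativeRing F
  open RS (rawSR F) using (product; _^_)
  open import Algebra.Properties.Semiring.Sum semiring using (sum; sum-init-last; sum-cong-≋; sum-replicate-zero)

  ∑-last : ∀ d (g : ℕ → Carrier) → sum {suc d} (g ∘ toℕ) ≈ sum {d} (g ∘ toℕ) + g d
  ∑-last d g = trans (sum-init-last {d} (g ∘ toℕ))
    (+-cong (sum-cong-≋ {d} (λ i → reflexive (≡.cong g (toℕ-inject₁ i)))) (reflexive (≡.cong g (toℕ-fromℕ d))))

  sumTo≈∑+last : ∀ d (g : ℕ → Carrier) → sumTo F d g ≈ sum {d} (g ∘ toℕ) + g d
  sumTo≈∑+last zero    g = sym (+-identityˡ _)
  sumTo≈∑+last (suc d) g = +-congʳ (trans (sumTo≈∑+last d g) (sym (∑-last d g)))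

  ∑-head : ∀ {n} (g : ℕ → Carrier) → (∀ i → g (suc i) ≈ 0#) → 0 < n → sum {n} (g ∘ toℕ) ≈ g 0
  ∑-head {suc n} g g[1+i]≈0 _ =
    trans (+-congˡ (trans (sum-cong-≋ {n} (g[1+i]≈0 ∘ toℕ)) (sum-replicate-zero n))) (+-identityʳ _)

  sumTo-cong : ∀ d {g h : ℕ → Carrier} → (∀ i → g i ≈ h i) → sumTo F d g ≈ sumTo F d h
  sumTo-cong zero    g≈h = g≈h 0
  sumTo-cong (suc d) g≈h = +-cong (sumTo-cong d g≈h) (g≈h (suc d))

  sumTo-head : ∀ d (g : ℕ → Carrier) → (∀ i → g (suc i) ≈ 0#) → sumTo F d g ≈ g 0
  sumTo-head zero    g g[1+i]≈0 = refl
  sumTo-head (suc d) g g[1+i]≈0 = trans (+-cong (sumTo-head d g g[1+i]≈0) (g[1+i]≈0 d)) (+-identityʳ _)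

  ∏-*-const : ∀ {n} (g : Fin n → Carrier) x → product (λ j → g j * x) ≈ product g * x ^ n
  ∏-*-const {n} g x = trans (∑-distrib-+ {n} g (λ _ → x)) (*-congˡ (sum-replicate n))
    where
    open import Algebra.Properties.CommutativeMonoid.Sum *-commutativeMonoid using (∑-distrib-+; sum-replicate)

module ShiftOperators {c ℓ} (F : CommutativeRing c ℓ) where

  open CommutativeRing F
  open import Algebra.Properties.CommutativeSemigroup +-commutativeSemigroup using (interchange)
  open import Relation.Binary.Reasoning.Setoid setoid

  Seq : Set c
  Seq = ℕ → Carrier

  -- a₀ ∷ a₁ ∷ … stands for the operator a₀ + a₁ T + ⋯ , where T is the shift (T b) n = b (suc n).
  Op : Set c
  Op = List Carrier

  act : Op → Seq → Seq
  act []      b n = 0#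
  act (a ∷ P) b n = a * b n + act P b (suc n)

  infixl 6 _+ₒ_
  infixl 7 _*ₒ_

  _+ₒ_ : Op → Op → Op
  []      +ₒ Q       = Q
  (a ∷ P) +ₒ []      = a ∷ P
  (a ∷ P) +ₒ (b ∷ Q) = (a + b) ∷ (P +ₒ Q)

  scale : Carrier → Op → Op
  scale x = List.map (x *_)

  _*ₒ_ : Op → Op → Op
  []      *ₒ Q = []
  (a ∷ P) *ₒ Q = scale a Q +ₒ (0# ∷ P *ₒ Q)

  1ₒ : Op
  1ₒ = 1# ∷ []

  act-cong : ∀ P {b b′ : Seq} → (∀ n → b n ≈ b′ n) → ∀ n → act P b n ≈ act P b′ n
  act-cong []      b≈b′ n = refl
  act-cong (a ∷ P) b≈b′ n = +-cong (*-congˡ (b≈b′ n)) (act-cong P b≈b′ (suc n))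

  act-suc : ∀ P (b : Seq) n → act P (b ∘ suc) n ≡ act P b (suc n)
  act-suc []      b n = ≡.refl
  act-suc (a ∷ P) b n = ≡.cong (a * b (suc n) +_) (act-suc P b (suc n))

  act-+ : ∀ P (b b′ : Seq) n → act P (λ m → b m + b′ m) n ≈ act P b n + act P b′ n
  act-+ []      b b′ n = sym (+-identityʳ 0#)
  act-+ (a ∷ P) b b′ n = begin
    a * (b n + b′ n) + act P (λ m → b m + b′ m) (suc n)         ≈⟨ +-cong (distribˡ a _ _) (act-+ P b b′ (suc n)) ⟩
    (a * b n + a * b′ n) + (act P b (suc n) + act P b′ (suc n)) ≈⟨ interchange _ _ _ _ ⟩
    (a * b n + act P b (suc n)) + (a * b′ n + act P b′ (suc n)) ∎

  act-* : ∀ P x (b : Seq) n → act P (λ m → x * b m) n ≈ x * act P b n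
  act-* []      x b n = sym (zeroʳ x)
  act-* (a ∷ P) x b n = begin
    a * (x * b n) + act P (λ m → x * b m) (suc n) ≈⟨ +-cong (x∙yz≈y∙xz a x (b n)) (act-* P x b (suc n)) ⟩
    x * (a * b n) + x * act P b (suc n)           ≈⟨ distribˡ x _ _ ⟨
    x * (a * b n + act P b (suc n))               ∎
    where open import Algebra.Properties.CommutativeSemigroup *-commutativeSemigroup using (x∙yz≈y∙xz)

  act-0 : ∀ P n → act P (λ _ → 0#) n ≈ 0#
  act-0 []      n = refl
  act-0 (a ∷ P) n = trans (+-cong (zeroʳ a) (act-0 P (suc n))) (+-identityʳ 0#)

  act-+ₒ : ∀ P Q (b : Seq) n → act (P +ₒ Q) b n ≈ act P b n + act Q b n
  act-+ₒ []      Q       b n = sym (+-identityˡ _)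
  act-+ₒ (a ∷ P) []      b n = sym (+-identityʳ _)
  act-+ₒ (a ∷ P) (a′ ∷ Q) b n = begin
    (a + a′) * b n + act (P +ₒ Q) b (suc n)                      ≈⟨ +-cong (distribʳ (b n) a a′) (act-+ₒ P Q b (suc n)) ⟩
    (a * b n + a′ * b n) + (act P b (suc n) + act Q b (suc n))   ≈⟨ interchange _ _ _ _ ⟩
    (a * b n + act P b (suc n)) + (a′ * b n + act Q b (suc n))   ∎

  act-scale : ∀ x P (b : Seq) n → act (scale x P) b n ≈ x * act P b n
  act-scale x []      b n = sym (zeroʳ x)
  act-scale x (a ∷ P) b n = begin
    (x * a) * b n + act (scale x P) b (suc n) ≈⟨ +-cong (*-assoc x a (b n)) (act-scale x P b (suc n)) ⟩
    x * (a * b n) + x * act P b (suc n)       ≈⟨ distribˡ x _ _ ⟨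
    x * (a * b n + act P b (suc n))           ∎

  act-*ₒ : ∀ P Q (b : Seq) n → act (P *ₒ Q) b n ≈ act P (act Q b) n
  act-*ₒ []      Q b n = refl
  act-*ₒ (a ∷ P) Q b n = begin
    act (scale a Q +ₒ (0# ∷ P *ₒ Q)) b n                  ≈⟨ act-+ₒ (scale a Q) _ b n ⟩
    act (scale a Q) b n + (0# * b n + act (P *ₒ Q) b (suc n))
      ≈⟨ +-cong (act-scale a Q b n) (trans (+-congʳ (zeroˡ _)) (+-identityˡ _)) ⟩
    a * act Q b n + act (P *ₒ Q) b (suc n)                ≈⟨ +-congˡ (act-*ₒ P Q b (suc n)) ⟩
    a * act Q b n + act P (act Q b) (suc n)               ∎

  act-comm : ∀ P Q (b : Seq) n → act P (act Q b) n ≈ act Q (act P b) n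
  act-comm []      Q b n = sym (act-0 Q n)
  act-comm (a ∷ P) Q b n = begin
    a * act Q b n + act P (act Q b) (suc n)                 ≈⟨ +-congˡ (act-comm P Q b (suc n)) ⟩
    a * act Q b n + act Q (act P b) (suc n)                 ≡⟨ ≡.cong (a * act Q b n +_) (act-suc Q (act P b) n) ⟨
    a * act Q b n + act Q (act P b ∘ suc) n                 ≈⟨ +-congʳ (act-* Q a b n) ⟨
    act Q (λ m → a * b m) n + act Q (act P b ∘ suc) n       ≈⟨ act-+ Q _ _ n ⟨
    act Q (act (a ∷ P) b) n                                 ∎

  infix 4 _≈ₒ_
  record _≈ₒ_ (P Q : Op) : Set (c ⊔ ℓ) where
    constructor by-act
    field act-≈ : ∀ (b : Seq) n → act P b n ≈ act Q b n
  open _≈ₒ_ public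

  ≈ₒ-isEquivalence : IsEquivalence _≈ₒ_
  ≈ₒ-isEquivalence = record
    { refl  = by-act λ b n → refl
    ; sym   = λ P≈Q → by-act λ b n → sym (act-≈ P≈Q b n)
    ; trans = λ P≈Q Q≈R → by-act λ b n → trans (act-≈ P≈Q b n) (act-≈ Q≈R b n)
    }

  +ₒ-cong : ∀ {P P′ Q Q′} → P ≈ₒ P′ → Q ≈ₒ Q′ → P +ₒ Q ≈ₒ P′ +ₒ Q′
  +ₒ-cong {P} {P′} {Q} {Q′} P≈P′ Q≈Q′ = by-act λ b n → begin
    act (P +ₒ Q) b n        ≈⟨ act-+ₒ P Q b n ⟩
    act P b n + act Q b n   ≈⟨ +-cong (act-≈ P≈P′ b n) (act-≈ Q≈Q′ b n) ⟩
    act P′ b n + act Q′ b n ≈⟨ act-+ₒ P′ Q′ b n ⟨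
    act (P′ +ₒ Q′) b n      ∎

  *ₒ-cong : ∀ {P P′ Q Q′} → P ≈ₒ P′ → Q ≈ₒ Q′ → P *ₒ Q ≈ₒ P′ *ₒ Q′
  *ₒ-cong {P} {P′} {Q} {Q′} P≈P′ Q≈Q′ = by-act λ b n → begin
    act (P *ₒ Q) b n      ≈⟨ act-*ₒ P Q b n ⟩
    act P (act Q b) n     ≈⟨ act-cong P (act-≈ Q≈Q′ b) n ⟩
    act P (act Q′ b) n    ≈⟨ act-≈ P≈P′ (act Q′ b) n ⟩
    act P′ (act Q′ b) n   ≈⟨ act-*ₒ P′ Q′ b n ⟨
    act (P′ *ₒ Q′) b n    ∎

  +ₒ-assoc : ∀ P Q R → (P +ₒ Q) +ₒ R ≈ₒ P +ₒ (Q +ₒ R)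
  +ₒ-assoc P Q R = by-act λ b n → begin
    act ((P +ₒ Q) +ₒ R) b n               ≈⟨ trans (act-+ₒ (P +ₒ Q) R b n) (+-congʳ (act-+ₒ P Q b n)) ⟩
    (act P b n + act Q b n) + act R b n   ≈⟨ +-assoc _ _ _ ⟩
    act P b n + (act Q b n + act R b n)   ≈⟨ trans (act-+ₒ P (Q +ₒ R) b n) (+-congˡ (act-+ₒ Q R b n)) ⟨
    act (P +ₒ (Q +ₒ R)) b n               ∎

  +ₒ-comm : ∀ P Q → P +ₒ Q ≈ₒ Q +ₒ P
  +ₒ-comm P Q = by-act λ b n → trans (act-+ₒ P Q b n) (trans (+-comm _ _) (sym (act-+ₒ Q P b n)))

  *ₒ-assoc : ∀ P Q R → (P *ₒ Q) *ₒ R ≈ₒ P *ₒ (Q *ₒ R)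
  *ₒ-assoc P Q R = by-act λ b n → begin
    act ((P *ₒ Q) *ₒ R) b n     ≈⟨ trans (act-*ₒ (P *ₒ Q) R b n) (act-*ₒ P Q (act R b) n) ⟩
    act P (act Q (act R b)) n   ≈⟨ act-cong P (λ m → act-*ₒ Q R b m) n ⟨
    act P (act (Q *ₒ R) b) n    ≈⟨ act-*ₒ P (Q *ₒ R) b n ⟨
    act (P *ₒ (Q *ₒ R)) b n     ∎

  *ₒ-comm : ∀ P Q → P *ₒ Q ≈ₒ Q *ₒ P
  *ₒ-comm P Q = by-act λ b n → trans (act-*ₒ P Q b n) (trans (act-comm P Q b n) (sym (act-*ₒ Q P b n)))

  act-1ₒ : ∀ (b : Seq) n → act 1ₒ b n ≈ b n
  act-1ₒ b n = trans (+-identityʳ _) (*-identityˡ _)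

  *ₒ-identityˡ : ∀ P → 1ₒ *ₒ P ≈ₒ P
  *ₒ-identityˡ P = by-act λ b n → trans (act-*ₒ 1ₒ P b n) (act-1ₒ (act P b) n)

  *ₒ-distribʳ : ∀ P Q R → (Q +ₒ R) *ₒ P ≈ₒ Q *ₒ P +ₒ R *ₒ P
  *ₒ-distribʳ P Q R = by-act λ b n → begin
    act ((Q +ₒ R) *ₒ P) b n                  ≈⟨ trans (act-*ₒ (Q +ₒ R) P b n) (act-+ₒ Q R (act P b) n) ⟩
    act Q (act P b) n + act R (act P b) n    ≈⟨ +-cong (act-*ₒ Q P b n) (act-*ₒ R P b n) ⟨
    act (Q *ₒ P) b n + act (R *ₒ P) b n      ≈⟨ act-+ₒ (Q *ₒ P) (R *ₒ P) b n ⟨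
    act (Q *ₒ P +ₒ R *ₒ P) b n               ∎

  ≈ₒ-isCommutativeSemiring : IsCommutativeSemiring _≈ₒ_ _+ₒ_ _*ₒ_ [] 1ₒ
  ≈ₒ-isCommutativeSemiring = isCommutativeSemiringˡ record
    { +-isCommutativeMonoid = isCommutativeMonoidˡ record
      { isSemigroup = record
        { isMagma = record { isEquivalence = ≈ₒ-isEquivalence ; ∙-cong = +ₒ-cong }
        ; assoc   = +ₒ-assoc }
      ; identityˡ = λ P → by-act λ b n → refl
      ; comm      = +ₒ-comm }
    ; *-isCommutativeMonoid = isCommutativeMonoidˡ record
      { isSemigroup = record
        { isMagma = record { isEquivalence = ≈ₒ-isEquivalence ; ∙-cong = *ₒ-cong }
        ; assoc   = *ₒ-assoc }
      ; identityˡ = *ₒ-identityˡ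
      ; comm      = *ₒ-comm }
    ; distribʳ = *ₒ-distribʳ
    ; zeroˡ    = λ P → by-act λ b n → refl }

  opSemiring : CommutativeSemiring c (c ⊔ ℓ)
  opSemiring = record { isCommutativeSemiring = ≈ₒ-isCommutativeSemiring }

  private module Op = CommutativeSemiring opSemiring

  open import Algebra.Properties.Semiring.Mult Op.semiring public using () renaming (_×_ to _×ₒ_)
  open import Algebra.Properties.Semiring.Exp Op.semiring public using () renaming (_^_ to _^ₒ_)
  open import Algebra.Properties.Semiring.Sum Op.semiring public using () renaming (sum to ∑ₒ)
  open import Algebra.Properties.Semiring.Mult semiring using (_×_)
  open import Algebra.Properties.Semiring.Exp semiring using (_^_)
  open import Algebra.Properties.Semiring.Sum semiring using (sum)

  act-× : ∀ k P (b : Seq) n → act (k ×ₒ P) b n ≈ k × act P b n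
  act-× zero    P b n = refl
  act-× (suc k) P b n = trans (act-+ₒ P (k ×ₒ P) b n) (+-congˡ (act-× k P b n))

  act-∑ : ∀ {k} (Ps : Fin k → Op) (b : Seq) n → act (∑ₒ Ps) b n ≈ sum (λ i → act (Ps i) b n)
  act-∑ {zero}  Ps b n = refl
  act-∑ {suc k} Ps b n = trans (act-+ₒ (Ps Fin.zero) _ b n) (+-congˡ (act-∑ (Ps ∘ Fin.suc) b n))

  const : Carrier → Op
  const x = x ∷ []

  T^ : ℕ → Op
  T^ zero    = 1ₒ
  T^ (suc a) = 0# ∷ T^ a

  act-const : ∀ x (b : Seq) n → act (const x) b n ≈ x * b n
  act-const x b n = +-identityʳ _

  act-T^ : ∀ a (b : Seq) n → act (T^ a) b n ≈ b (n ℕ.+ a)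
  act-T^ zero    b n = trans (act-1ₒ b n) (reflexive (≡.cong b (≡.sym (ℕ.+-identityʳ n))))
  act-T^ (suc a) b n = begin
    0# * b n + act (T^ a) b (suc n) ≈⟨ +-cong (zeroˡ _) (act-T^ a b (suc n)) ⟩
    0# + b (suc n ℕ.+ a)            ≈⟨ +-identityˡ _ ⟩
    b (suc n ℕ.+ a)                 ≡⟨ ≡.cong b (ℕ.+-suc n a) ⟨
    b (n ℕ.+ suc a)                 ∎

  act-const-^ : ∀ x m (b : Seq) n → act (const x ^ₒ m) b n ≈ x ^ m * b n
  act-const-^ x zero    b n = trans (act-1ₒ b n) (sym (*-identityˡ _))
  act-const-^ x (suc m) b n = begin
    act (const x *ₒ const x ^ₒ m) b n
      ≈⟨ trans (act-*ₒ (const x) (const x ^ₒ m) b n) (act-const x (act (const x ^ₒ m) b) n) ⟩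
    x * act (const x ^ₒ m) b n        ≈⟨ *-congˡ (act-const-^ x m b n) ⟩
    x * (x ^ m * b n)                 ≈⟨ *-assoc _ _ _ ⟨
    x ^ suc m * b n                   ∎

  act-T^-^ : ∀ a m (b : Seq) n → act (T^ a ^ₒ m) b n ≈ b (n ℕ.+ m ℕ.* a)
  act-T^-^ a zero    b n = trans (act-1ₒ b n) (reflexive (≡.cong b (≡.sym (ℕ.+-identityʳ n))))
  act-T^-^ a (suc m) b n = begin
    act (T^ a *ₒ T^ a ^ₒ m) b n      ≈⟨ trans (act-*ₒ (T^ a) _ b n) (act-T^ a _ n) ⟩
    act (T^ a ^ₒ m) b (n ℕ.+ a)      ≈⟨ act-T^-^ a m b (n ℕ.+ a) ⟩
    b (n ℕ.+ a ℕ.+ m ℕ.* a)          ≡⟨ ≡.cong b (ℕ.+-assoc n a (m ℕ.* a)) ⟩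
    b (n ℕ.+ suc m ℕ.* a)            ∎

  act-^-agree : ∀ {P Q} {b : Seq} → (∀ n → act P b n ≈ act Q b n) → ∀ m n → act (P ^ₒ m) b n ≈ act (Q ^ₒ m) b n
  act-^-agree {P} {Q} {b} P≈Q zero    n = refl
  act-^-agree {P} {Q} {b} P≈Q (suc m) n = begin
    act (P *ₒ P ^ₒ m) b n       ≈⟨ act-*ₒ P (P ^ₒ m) b n ⟩
    act P (act (P ^ₒ m) b) n    ≈⟨ act-cong P (act-^-agree P≈Q m) n ⟩
    act P (act (Q ^ₒ m) b) n    ≈⟨ act-comm P (Q ^ₒ m) b n ⟩
    act (Q ^ₒ m) (act P b) n    ≈⟨ act-cong (Q ^ₒ m) P≈Q n ⟩
    act (Q ^ₒ m) (act Q b) n    ≈⟨ act-comm Q (Q ^ₒ m) b n ⟨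
    act Q (act (Q ^ₒ m) b) n    ≈⟨ act-*ₒ Q (Q ^ₒ m) b n ⟨
    act (Q *ₒ Q ^ₒ m) b n       ∎

  act-monomial : ∀ x a (b : Seq) n → act (const x *ₒ T^ a) b n ≈ x * b (n ℕ.+ a)
  act-monomial x a b n =
    trans (act-*ₒ (const x) (T^ a) b n) (trans (act-const x (act (T^ a) b) n) (*-congˡ (act-T^ a b n)))

  act-monomial-^ : ∀ x a m (b : Seq) n → act ((const x *ₒ T^ a) ^ₒ m) b n ≈ x ^ m * b (n ℕ.+ m ℕ.* a)
  act-monomial-^ x a m b n = begin
    act ((const x *ₒ T^ a) ^ₒ m) b n           ≈⟨ act-≈ (^-distrib-* (const x) (T^ a) m) b n ⟩
    act (const x ^ₒ m *ₒ T^ a ^ₒ m) b n        ≈⟨ act-*ₒ (const x ^ₒ m) (T^ a ^ₒ m) b n ⟩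
    act (const x ^ₒ m) (act (T^ a ^ₒ m) b) n   ≈⟨ act-const-^ x m _ n ⟩
    x ^ m * act (T^ a ^ₒ m) b n                ≈⟨ *-congˡ (act-T^-^ a m b n) ⟩
    x ^ m * b (n ℕ.+ m ℕ.* a)                  ∎
    where open import Algebra.Properties.CommutativeSemiring.Exp opSemiring using (^-distrib-*)

-- Holds for every sum X of t powers qⁱ with i < d; such an X stays below q ^ d as long as t < q.
Small : (q d t X : ℕ) → Set
Small q d t X = q ℕ.* X ≤ t ℕ.* q ℕ.^ d

module _ {q d : ℕ} .{{q≢0 : ℕ.NonZero q}} where

  small-+q^ : ∀ {t X i} → Small q d t X → i < d → Small q d (suc t) (X ℕ.+ q ℕ.^ i)
  small-+q^ {t} {X} {i} X-small i<d = begin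
    q ℕ.* (X ℕ.+ q ℕ.^ i)           ≡⟨ ℕ.*-distribˡ-+ q X (q ℕ.^ i) ⟩
    q ℕ.* X ℕ.+ q ℕ.^ suc i         ≤⟨ ℕ.+-mono-≤ X-small (ℕ.^-monoʳ-≤ q i<d) ⟩
    t ℕ.* q ℕ.^ d ℕ.+ q ℕ.^ d       ≡⟨ ℕ.+-comm (t ℕ.* q ℕ.^ d) (q ℕ.^ d) ⟩
    suc t ℕ.* q ℕ.^ d               ∎
    where open ℕ.≤-Reasoning

  small⇒<q^d : ∀ {t X} → Small q d t X → t < q → X < q ℕ.^ d
  small⇒<q^d {t} {X} X-small t<q =
    ℕ.*-cancelˡ-< q X (q ℕ.^ d) (ℕ.≤-<-trans X-small (ℕ.*-monoˡ-< (q ℕ.^ d) {{ℕ.m^n≢0 q d}} t<q))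

module ShiftReduction {c ℓ} (F : CommutativeRing c ℓ) {p : ℕ} (p-prime : Prime p) (e d : ℕ) where

  open CommutativeRing F
  open ShiftOperators F
  open FiniteSums F
  open import Algebra.Properties.Semiring.Mult semiring using (_×_)
  open import Algebra.Properties.Semiring.Exp semiring using (_^_)
  open import Algebra.Properties.Semiring.Sum semiring using (sum; sum-cong-≋; ∑-distrib-+; *-distribˡ-sum)
  open import Relation.Binary.Reasoning.Setoid setoid

  q : ℕ
  q = p ℕ.^ e

  instance
    q≢0 : ℕ.NonZero q
    q≢0 = ℕ.m^n≢0 p e {{prime⇒nonZero p-prime}}

  ∑q^ : ∀ {s} → (Fin s → ℕ) → ℕ
  ∑q^ k = RS.sum ℕ.+-*-rawSemiring (λ j → q ℕ.^ k j)

  module _ (char-p : p × 1# ≈ 0#) where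

    private
      op-char : p ×ₒ 1ₒ ≈ₒ []
      op-char = by-act λ b n →
        trans (act-× p 1ₒ b n) (Multiples.n×-vanishes semiring {p} char-p _)

      module Frobeniusₒ = Frobenius opSemiring p-prime op-char

    linTerms : (ℕ → Carrier) → Fin d → Op
    linTerms λs i = const (λs (toℕ i)) *ₒ T^ (q ℕ.^ toℕ i)

    linOp : Carrier → (ℕ → Carrier) → Op
    linOp c λs = const c +ₒ ∑ₒ (linTerms λs)

    linOp-^q : ∀ c λs (b : Seq) n →
      act (linOp c λs ^ₒ q) b n ≈ c ^ q * b n + sum {d} (λ i → λs (toℕ i) ^ q * b (n ℕ.+ q ℕ.^ suc (toℕ i)))
    linOp-^q c λs b n = begin
      act ((const c +ₒ ∑ₒ terms) ^ₒ q) b n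
        ≈⟨ act-≈ (Frobeniusₒ.frobenius-^ e (const c) (∑ₒ terms)) b n ⟩
      act (const c ^ₒ q +ₒ ∑ₒ terms ^ₒ q) b n
        ≈⟨ act-+ₒ (const c ^ₒ q) _ b n ⟩
      act (const c ^ₒ q) b n + act (∑ₒ terms ^ₒ q) b n
        ≈⟨ +-cong (act-const-^ c q b n) (act-≈ (Frobeniusₒ.frobenius-sum e terms) b n) ⟩
      c ^ q * b n + act (∑ₒ (λ i → terms i ^ₒ q)) b n
        ≈⟨ +-congˡ (act-∑ (λ i → terms i ^ₒ q) b n) ⟩
      c ^ q * b n + sum {d} (λ i → act (terms i ^ₒ q) b n)
        ≈⟨ +-congˡ (sum-cong-≋ {d} λ i → act-monomial-^ (λs (toℕ i)) (q ℕ.^ toℕ i) q b n) ⟩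
      c ^ q * b n + sum {d} (λ i → λs (toℕ i) ^ q * b (n ℕ.+ q ℕ.^ suc (toℕ i))) ∎
      where terms = linTerms λs

    module Recurrence (f : ℕ → Carrier) {f-d⁻¹ : Carrier} (f-d-inverse : f d * f-d⁻¹ ≈ 1#) (b : Seq)
             (recurrence : ∀ n → b n ≈ sumTo F d (λ i → f i * b (n ℕ.+ q ℕ.^ i))) where

      open import Algebra.Properties.Ring ring using (-‿distribˡ-*; xyx⁻¹≈y)
      open import Algebra.Properties.CommutativeSemigroup +-commutativeSemigroup using (interchange)

      lincomb : Carrier → (ℕ → Carrier) → Seq
      lincomb c λs n = c * b n + sum {d} (λ i → λs (toℕ i) * b (n ℕ.+ q ℕ.^ toℕ i))

      act-linOp : ∀ c λs n → act (linOp c λs) b n ≈ lincomb c λs n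
      act-linOp c λs n = trans (act-+ₒ (const c) (∑ₒ (linTerms λs)) b n)
        (+-cong (act-const c b n)
                (trans (act-∑ (linTerms λs) b n) (sum-cong-≋ {d} λ i → act-monomial (λs (toℕ i)) (q ℕ.^ toℕ i) b n)))

      lincomb-+-* : ∀ c λs c′ λs′ x n →
        lincomb c λs n + x * lincomb c′ λs′ n ≈ lincomb (c + x * c′) (λ i → λs i + x * λs′ i) n
      lincomb-+-* c λs c′ λs′ x n = begin
        (c * B + S λs) + x * (c′ * B + S λs′)           ≈⟨ +-congˡ (trans (distribˡ x _ _) (+-congʳ (sym (*-assoc x c′ B)))) ⟩
        (c * B + S λs) + ((x * c′) * B + x * S λs′)     ≈⟨ interchange _ _ _ _ ⟩
        (c * B + (x * c′) * B) + (S λs + x * S λs′)     ≈⟨ +-cong (sym (distribʳ B c _)) (+-congˡ (*-distribˡ-sum {d} x _)) ⟩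
        (c + x * c′) * B + (S λs + sum {d} (λ i → x * (λs′ (toℕ i) * v i)))
          ≈⟨ +-congˡ (trans (sym (∑-distrib-+ {d} _ _)) (sum-cong-≋ {d} λ i →
               trans (+-congˡ (sym (*-assoc x _ _))) (sym (distribʳ (v i) _ _)))) ⟩
        (c + x * c′) * B + sum {d} (λ i → (λs (toℕ i) + x * λs′ (toℕ i)) * v i) ∎
        where
        B = b n
        v : Fin d → Carrier
        v i = b (n ℕ.+ q ℕ.^ toℕ i)
        S : (ℕ → Carrier) → Carrier
        S λs = sum {d} (λ i → λs (toℕ i) * v i)

      record Reduction (m : ℕ) : Set (c ⊔ ℓ) where
        field
          constant : Carrier
          coeff    : ℕ → Carrier
          reduces  : ∀ n → b (n ℕ.+ q ℕ.^ m) ≈ lincomb constant coeff n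
      open Reduction

      top-reduction : Reduction d
      top-reduction = record { constant = f-d⁻¹ ; coeff = λ i → - f-d⁻¹ * f i ; reduces = reduces-d }
        where
        reduces-d : ∀ n → b (n ℕ.+ q ℕ.^ d) ≈ lincomb f-d⁻¹ (λ i → - f-d⁻¹ * f i) n
        reduces-d n = sym (begin
          f-d⁻¹ * b n + sum {d} (λ i → - f-d⁻¹ * f (toℕ i) * v i)
            ≈⟨ +-cong (*-congˡ (trans (recurrence n) (sumTo≈∑+last d _)))
                      (trans (sum-cong-≋ {d} λ i → *-assoc _ _ _) (sym (*-distribˡ-sum {d} (- f-d⁻¹) _))) ⟩
          f-d⁻¹ * (S + f d * Y) + - f-d⁻¹ * S           ≈⟨ +-cong (distribˡ f-d⁻¹ S _) (sym (-‿distribˡ-* f-d⁻¹ S)) ⟩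
          f-d⁻¹ * S + f-d⁻¹ * (f d * Y) + - (f-d⁻¹ * S) ≈⟨ xyx⁻¹≈y _ _ ⟩
          f-d⁻¹ * (f d * Y)                             ≈⟨ sym (*-assoc _ _ _) ⟩
          (f-d⁻¹ * f d) * Y                             ≈⟨ *-congʳ (trans (*-comm _ _) f-d-inverse) ⟩
          1# * Y                                        ≈⟨ *-identityˡ Y ⟩
          Y                                             ∎)
          where
          v : Fin d → Carrier
          v i = b (n ℕ.+ q ℕ.^ toℕ i)
          S = sum {d} (λ i → f (toℕ i) * v i)
          Y = b (n ℕ.+ q ℕ.^ d)

      zero-reduction : Reduction 0
      zero-reduction with ℕ.m≤n⇒m<n∨m≡n (z≤n {d})
      ... | inj₂ 0≡d = ≡.subst Reduction (≡.sym 0≡d) top-reduction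
      ... | inj₁ 0<d = record { constant = 0# ; coeff = δ₀ ; reduces = reduces-0 }
        where
        δ₀ : ℕ → Carrier
        δ₀ zero    = 1#
        δ₀ (suc _) = 0#
        reduces-0 : ∀ n → b (n ℕ.+ 1) ≈ lincomb 0# δ₀ n
        reduces-0 n = sym (begin
          0# * b n + sum {d} (λ i → δ₀ (toℕ i) * b (n ℕ.+ q ℕ.^ toℕ i))
            ≈⟨ +-cong (zeroˡ _) (∑-head {d} (λ j → δ₀ j * b (n ℕ.+ q ℕ.^ j)) (λ _ → zeroˡ _) 0<d) ⟩
          0# + 1# * b (n ℕ.+ 1)
            ≈⟨ trans (+-identityˡ _) (*-identityˡ _) ⟩
          b (n ℕ.+ 1) ∎)

      frobenius-coeff : (ℕ → Carrier) → ℕ → Carrier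
      frobenius-coeff λs zero    = 0#
      frobenius-coeff λs (suc i) = λs i ^ q

      next-reduction : ∀ {m} → Reduction m → Reduction (suc m)
      next-reduction {m} R = record
        { constant = κ ^ q + μ d * constant top-reduction
        ; coeff    = λ i → μ i + μ d * coeff top-reduction i
        ; reduces  = λ n → begin
            b (n ℕ.+ q ℕ.^ suc m)                ≈⟨ act-T^-^ (q ℕ.^ m) q b n ⟨
            act (T^ (q ℕ.^ m) ^ₒ q) b n          ≈⟨ act-^-agree T^q^m≈linOp q n ⟩
            act (linOp κ λs ^ₒ q) b n            ≈⟨ linOp-^q κ λs b n ⟩
            κ ^ q * b n + sum {d} (λ i → μ (suc (toℕ i)) * v n (suc (toℕ i))) ≈⟨ +-congˡ (reindex n) ⟩
            κ ^ q * b n + (sum {d} (λ i → μ (toℕ i) * v n (toℕ i)) + μ d * v n d) ≈⟨ +-assoc _ _ _ ⟨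
            lincomb (κ ^ q) μ n + μ d * v n d    ≈⟨ +-congˡ (*-congˡ (reduces top-reduction n)) ⟩
            lincomb (κ ^ q) μ n + μ d * lincomb (constant top-reduction) (coeff top-reduction) n
              ≈⟨ lincomb-+-* (κ ^ q) μ (constant top-reduction) (coeff top-reduction) (μ d) n ⟩
            lincomb (κ ^ q + μ d * constant top-reduction) (λ i → μ i + μ d * coeff top-reduction i) n ∎
        }
        where
        κ  = constant R
        λs = coeff R
        μ  = frobenius-coeff λs
        T^q^m≈linOp : ∀ n → act (T^ (q ℕ.^ m)) b n ≈ act (linOp κ λs) b n
        T^q^m≈linOp n = trans (act-T^ (q ℕ.^ m) b n) (trans (reduces R n) (sym (act-linOp κ λs n)))
        v : ℕ → ℕ → Carrier
        v n j = b (n ℕ.+ q ℕ.^ j)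
        reindex : ∀ n → sum {d} (λ i → μ (suc (toℕ i)) * v n (suc (toℕ i)))
                        ≈ sum {d} (λ i → μ (toℕ i) * v n (toℕ i)) + μ d * v n d
        reindex n = trans (sym (trans (+-congʳ (zeroˡ _)) (+-identityˡ _))) (∑-last d (λ j → μ j * v n j))

      reduction : ∀ m → Reduction m
      reduction zero    = zero-reduction
      reduction (suc m) = next-reduction (reduction m)

      module _ (vanishes : ∀ M → 1 ≤ M → M < q ℕ.^ d → b M ≈ 0#) where

        open RS (rawSR F) using (product)
        open import Algebra.Properties.CommutativeSemigroup ℕ.+-commutativeSemigroup using (x∙yz≈xz∙y; xy∙z≈xz∙y)

        b-+-∑q^ : ∀ s (k : Fin s → ℕ) {t X} → t ℕ.+ s < q → Small q d t X →
                  b (X ℕ.+ ∑q^ k) ≈ product (λ j → constant (reduction (k j))) * b X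
        b-+-∑q^ zero    k {t} {X} _       _       = trans (reflexive (≡.cong b (ℕ.+-identityʳ X))) (sym (*-identityˡ _))
        b-+-∑q^ (suc s) k {t} {X} t+s+1<q X-small = begin
          b (X ℕ.+ (q ℕ.^ k₀ ℕ.+ R))    ≡⟨ ≡.cong b (x∙yz≈xz∙y X (q ℕ.^ k₀) R) ⟩
          b (X ℕ.+ R ℕ.+ q ℕ.^ k₀)      ≈⟨ reduces (reduction k₀) (X ℕ.+ R) ⟩
          κ * b (X ℕ.+ R) + sum {d} (λ i → λs (toℕ i) * b (X ℕ.+ R ℕ.+ q ℕ.^ toℕ i))
            ≈⟨ +-cong (*-congˡ (b-+-∑q^ s k′ {t} t+s<q X-small))
                      (trans (sum-cong-≋ {d} λ i → trans (*-congˡ (shifted-vanishes i)) (zeroʳ _)) (sum-replicate-zero d)) ⟩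
          κ * (Π′ * b X) + 0#           ≈⟨ trans (+-identityʳ _) (sym (*-assoc _ _ _)) ⟩
          (κ * Π′) * b X                ∎
          where
          open import Algebra.Properties.Semiring.Sum semiring using (sum-replicate-zero)
          k₀ = k Fin.zero
          k′ = k ∘ Fin.suc
          R  = ∑q^ k′
          κ  = constant (reduction k₀)
          λs = coeff (reduction k₀)
          Π′ = product (λ j → constant (reduction (k′ j)))
          t+s<q : t ℕ.+ s < q
          t+s<q = ℕ.≤-<-trans (ℕ.+-monoʳ-≤ t (ℕ.n≤1+n s)) t+s+1<q
          shifted-vanishes : ∀ (i : Fin d) → b (X ℕ.+ R ℕ.+ q ℕ.^ toℕ i) ≈ 0#
          shifted-vanishes i = begin
            b (X ℕ.+ R ℕ.+ q ℕ.^ toℕ i)   ≡⟨ ≡.cong b (xy∙z≈xz∙y X R (q ℕ.^ toℕ i)) ⟩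
            b (X ℕ.+ q ℕ.^ toℕ i ℕ.+ R)   ≈⟨ b-+-∑q^ s k′ {suc t} (≡.subst (_< q) (ℕ.+-suc t s) t+s+1<q) Y-small ⟩
            Π′ * b (X ℕ.+ q ℕ.^ toℕ i)    ≈⟨ *-congˡ (vanishes _ 1≤Y (small⇒<q^d {q} {d} Y-small t+1<q)) ⟩
            Π′ * 0#                        ≈⟨ zeroʳ Π′ ⟩
            0#                             ∎
            where
            Y-small : Small q d (suc t) (X ℕ.+ q ℕ.^ toℕ i)
            Y-small = small-+q^ {q} {d} {t} X-small (toℕ<n i)
            1≤Y : 1 ≤ X ℕ.+ q ℕ.^ toℕ i
            1≤Y = ℕ.≤-trans (ℕ.m^n>0 q (toℕ i)) (ℕ.m≤n+m _ X)
            t+1<q : suc t < q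
            t+1<q = ℕ.≤-<-trans (ℕ.+-monoʳ-≤ 1 (ℕ.m≤m+n t s)) (≡.subst (_< q) (ℕ.+-suc t s) t+s+1<q)

j+[Q∸M]<Q⇒j<M : ∀ {j M Q} → M ≤ Q → j ℕ.+ (Q ∸ M) < Q → j < M
j+[Q∸M]<Q⇒j<M {j} {M} {Q} M≤Q j+[Q∸M]<Q =
  ℕ.+-cancelʳ-< (Q ∸ M) j M (≡.subst (j ℕ.+ (Q ∸ M) <_) (≡.sym (ℕ.m+[n∸m]≡n M≤Q)) j+[Q∸M]<Q)

module Expansion {c ℓ} (F : CommutativeRing c ℓ) (F-field : IsField F)
  {p : ℕ} (p-prime : Prime p) {e : ℕ} (1≤e : 1 ≤ e) (𝔽q : ContainsFq F (p ℕ.^ e))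
  (d : ℕ) (f : ℕ → CommutativeRing.Carrier F) (f-d≉0 : ¬ CommutativeRing._≈_ F (f d) (CommutativeRing.0# F))
  (A : ℕ → CommutativeRing.Carrier F) (expansion : IsExpansion F (p ℕ.^ e) d f A) where

  open CommutativeRing F
  open IsField F-field using (inverse)
  open FieldProperties F F-field using (*-cancelˡ-≈0)
  open FiniteSums F
  open ShiftOperators F using (Seq)
  open Characteristic F F-field 𝔽q using (q×1≈0; prime-power⇒char)
  open import Algebra.Properties.Semiring.Mult semiring using (_×_)
  open import Algebra.Properties.Semiring.Sum semiring using (sum; sum-cong-≋; sum-replicate-zero)
  open import Algebra.Properties.Ring ring using (x∙y⁻¹≈ε⇒x≈y; -‿injective; -0#≈0#)
  open import Relation.Binary.Reasoning.Setoid setoid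

  open ShiftReduction F p-prime e d using (q; q≢0; ∑q^; module Recurrence)

  q>1 : 1 < q
  q>1 = ℕ.<-≤-trans (prime≥2 p-prime)
    (ℕ.≤-trans (ℕ.≤-reflexive (≡.sym (ℕ.*-identityʳ p))) (ℕ.^-monoʳ-≤ p {{prime⇒nonZero p-prime}} 1≤e))

  b : Seq
  b zero    = f 0
  b (suc n) = A n

  ext-⊖-< : ∀ {M k} → k < M → ext F A (M ℤ.⊖ suc k) ≡ b (M ∸ k)
  ext-⊖-< {M} {k} k<M rewrite ℤ.⊖-≥ k<M = ≡.cong b (≡.sym (ℕ.+-∸-assoc 1 k<M))

  ext-⊖-≥ : ∀ {M k} → M ≤ k → ext F A (M ℤ.⊖ suc k) ≡ 0#
  ext-⊖-≥ {M} {k} M≤k rewrite ℤ.⊖-< (s≤s M≤k) | ℕ.+-∸-assoc 1 M≤k = ≡.refl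

  ext-⊖-vanishes : ∀ M k → (∀ j → 1 ≤ j → j ℕ.+ k ≤ M → b j ≈ 0#) → ext F A (M ℤ.⊖ suc k) ≈ 0#
  ext-⊖-vanishes M k b-vanishes with k ℕ.<? M
  ... | yes k<M = trans (reflexive (ext-⊖-< k<M))
                        (b-vanishes (M ∸ k) (ℕ.m<n⇒0<n∸m k<M) (ℕ.≤-reflexive (ℕ.m∸n+n≡m (ℕ.<⇒≤ k<M))))
  ... | no  k≮M = reflexive (ext-⊖-≥ (ℕ.≮⇒≥ k≮M))

  expansion-rhs : ∀ n → sumTo F d (λ i → if does (n ℤ.≟ ℤ.- (ℤ.+ (q ℕ.^ i))) then - ((q ℕ.^ i) × f i) else 0#)
                        ≈ (if does (n ℤ.≟ -[1+ 0 ]) then - (1 × f 0) else 0#)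
  expansion-rhs n = sumTo-head d _ λ i → if-vanishes _ (Multiples.×-vanishes semiring {q} q×1≈0 (m∣m*n (q ℕ.^ i)) (f (suc i)))
    where
    if-vanishes : ∀ (B : Bool) {x} → x ≈ 0# → (if B then - x else 0#) ≈ 0#
    if-vanishes true  x≈0 = trans (-‿cong x≈0) -0#≈0#
    if-vanishes false x≈0 = refl

  recurrence : ∀ N → b N ≈ sumTo F d (λ i → f i * b (N ℕ.+ q ℕ.^ i))
  recurrence zero    = -‿injective (begin
    - f 0                                                    ≈⟨ -‿cong (+-identityʳ (f 0)) ⟨
    - (1 × f 0)                                              ≈⟨ trans (expansion -[1+ 0 ]) (expansion-rhs -[1+ 0 ]) ⟨
    0# - sumTo F d (λ i → f i * ext F A (q ℕ.^ i ℤ.⊖ 1))     ≈⟨ +-identityˡ _ ⟩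
    - sumTo F d (λ i → f i * ext F A (q ℕ.^ i ℤ.⊖ 1))
      ≈⟨ -‿cong (sumTo-cong d λ i → *-congˡ (reflexive (ext-⊖-< (ℕ.m^n>0 q i)))) ⟩
    - sumTo F d (λ i → f i * b (q ℕ.^ i))                    ∎)
  recurrence (suc n) = x∙y⁻¹≈ε⇒x≈y _ _ (trans (expansion (ℤ.+ n)) (expansion-rhs (ℤ.+ n)))

  lagged-equation : ∀ k → 1 ≤ k → sumTo F d (λ i → f i * ext F A (q ℕ.^ i ℤ.⊖ suc k)) ≈ 0#
  lagged-equation (suc k) _ = sym (x∙y⁻¹≈ε⇒x≈y _ _ (trans (expansion -[1+ suc k ]) (expansion-rhs -[1+ suc k ])))

  vanishes : ∀ M → 1 ≤ M → M < q ℕ.^ d → b M ≈ 0#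
  vanishes = <-rec (λ M → 1 ≤ M → M < q ℕ.^ d → b M ≈ 0#) step
    where
    step : ∀ M → (∀ {j} → j < M → 1 ≤ j → j < q ℕ.^ d → b j ≈ 0#) → 1 ≤ M → M < q ℕ.^ d → b M ≈ 0#
    -- Apart from f d * b M, the u^(-k) equation with k = q ^ d ∸ M only involves b below M.
    step M IH 1≤M M<Q = *-cancelˡ-≈0 f-d≉0 (begin
      f d * b M                                          ≡⟨ ≡.cong (λ j → f d * b j) (ℕ.m∸[m∸n]≡n (ℕ.<⇒≤ M<Q)) ⟨
      f d * b (Q ∸ k)                                    ≡⟨ ≡.cong (f d *_) (ext-⊖-< k<Q) ⟨
      g d                                                ≈⟨ +-identityˡ _ ⟨
      0# + g d
        ≈⟨ +-congʳ (trans (sum-cong-≋ {d} (lower-vanishes ∘ toℕ<n)) (sum-replicate-zero d)) ⟨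
      sum {d} (g ∘ toℕ) + g d                            ≈⟨ sumTo≈∑+last d g ⟨
      sumTo F d g                                        ≈⟨ lagged-equation k (ℕ.m<n⇒0<n∸m M<Q) ⟩
      0#                                                 ∎)
      where
      Q = q ℕ.^ d
      k = Q ∸ M
      k<Q : k < Q
      k<Q = ℕ.∸-monoʳ-< 1≤M (ℕ.<⇒≤ M<Q)
      g : ℕ → Carrier
      g i = f i * ext F A (q ℕ.^ i ℤ.⊖ suc k)
      lower-vanishes : ∀ {i} → i < d → g i ≈ 0#
      lower-vanishes {i} i<d = trans (*-congˡ (ext-⊖-vanishes (q ℕ.^ i) k below-M)) (zeroʳ _)
        where
        below-M : ∀ j → 1 ≤ j → j ℕ.+ k ≤ q ℕ.^ i → b j ≈ 0#
        below-M j 1≤j j+k≤q^i = IH j<M 1≤j (ℕ.<-trans j<M M<Q)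
          where
          j<M : j < M
          j<M = j+[Q∸M]<Q⇒j<M (ℕ.<⇒≤ M<Q) (ℕ.≤-<-trans j+k≤q^i (ℕ.^-monoʳ-< q q>1 i<d))

  private
    char-p : p × 1# ≈ 0#
    char-p = prime-power⇒char {p} {e} ≡.refl

  open Recurrence char-p f (proj₂ (inverse (f d) f-d≉0)) b recurrence using (Reduction; reduction; b-+-∑q^)
  open RS (rawSR F) using (product)

  κ : ℕ → Carrier
  κ m = Reduction.constant (reduction m)

  A-pred : ∀ {N} → 1 ≤ N → A (N ∸ 1) ≡ b N
  A-pred {suc N} _ = ≡.refl

  A-∑q^ : ∀ s (k : Fin s → ℕ) → 1 ≤ s → s < q → A (∑q^ k ∸ 1) ≈ product (κ ∘ k) * f 0
  A-∑q^ (suc s) k _ s<q =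
    trans (reflexive (A-pred 1≤∑q^)) (b-+-∑q^ vanishes (suc s) k {0} {0} s<q (ℕ.≤-reflexive (ℕ.*-zeroʳ q)))
    where
    1≤∑q^ : 1 ≤ ∑q^ k
    1≤∑q^ = ℕ.≤-trans (ℕ.m^n>0 q (k Fin.zero)) (ℕ.m≤m+n _ _)

  A-q^ : ∀ m → A (q ℕ.^ m ∸ 1) ≈ κ m * f 0
  A-q^ m = begin
    A (q ℕ.^ m ∸ 1)               ≡⟨ ≡.cong (λ N → A (N ∸ 1)) (ℕ.+-identityʳ (q ℕ.^ m)) ⟨
    A (∑q^ {1} (λ _ → m) ∸ 1)     ≈⟨ A-∑q^ 1 (λ _ → m) (s≤s z≤n) q>1 ⟩
    (κ m * 1#) * f 0              ≈⟨ *-congʳ (*-identityʳ (κ m)) ⟩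
    κ m * f 0                     ∎

theorem6 : {c ℓ : Level} (F : CommutativeRing c ℓ) → IsField F →
    (q : ℕ) → IsPrimePower q → ContainsFq F q →
    (d : ℕ) (f : ℕ → CommutativeRing.Carrier F) →
    ¬ (CommutativeRing._≈_ F (f d) (CommutativeRing.0# F)) →
    (A : ℕ → CommutativeRing.Carrier F) → IsExpansion F q d f A →
    (s : ℕ) → 1 ≤ s → s < q → (k : Fin s → ℕ) →
    CommutativeRing._≈_ F
      (RS.product (rawSR F) (λ j → A ((q ℕ.^ k j) ∸ 1)))
      (CommutativeRing._*_ F
        (RS._^_ (rawSR F) (f 0) (s ∸ 1))
        (A (RS.sum ℕ.+-*-rawSemiring (λ j → q ℕ.^ k j) ∸ 1)))
theorem6 F F-field q (p , e , p-prime , 1≤e , ≡.refl) 𝔽q d f f-d≉0 A expansion (suc s) 1≤s s<q k = begin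
  product (λ j → A (q ℕ.^ k j ∸ 1))      ≈⟨ sum-cong-≋ (λ j → A-q^ (k j)) ⟩
  product (λ j → κ (k j) * f 0)          ≈⟨ ∏-*-const (κ ∘ k) (f 0) ⟩
  product (κ ∘ k) * (f 0 * f 0 ^ s)      ≈⟨ x∙yz≈z∙xy _ _ _ ⟩
  f 0 ^ s * (product (κ ∘ k) * f 0)      ≈⟨ *-congˡ (A-∑q^ (suc s) k 1≤s s<q) ⟨
  f 0 ^ s * A (∑q^ k ∸ 1)                ∎
  where
  open CommutativeRing F
  open RS (rawSR F) using (product; _^_)
  open import Algebra.Properties.CommutativeMonoid.Sum *-commutativeMonoid using (sum-cong-≋)
  open import Algebra.Properties.CommutativeSemigroup *-commutativeSemigroup using (x∙yz≈z∙xy)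
  open import Relation.Binary.Reasoning.Setoid setoid
  open FiniteSums F using (∏-*-const)
  open ShiftReduction F p-prime e d using (∑q^)
  open Expansion F F-field p-prime 1≤e 𝔽q d f f-d≉0 A expansion using (κ; A-q^; A-∑q^)
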